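{- Let $R$ be an integral domain of characteristic zero, let $n\ge 2$, and let $M=(m_{i,j})\in \operatorname{Frac}(R)^{n\times n}$ be a frieze matrix. Define $T_M=(t_{i,j})\in \operatorname{Frac}(R)^{n\times n}$ by \[ t_{i,j}=\begin{cases} m_{2,j} & \text{if } i=1,\\ m_{1,j} & \text{if } i=2,\\ 0 & \text{if } i\ge 3 \text{ and } j<i,\\ \dfrac{ -2m_{1,j}}{m_{1,i-1}}\,m_{i-1,i} & \text{if } i\ge 3 \text{ and } j\ge i.\end{cases} \] Then: (a) $t_{i,j}t_{i+1,j+1}-t_{i+1,j}t_{i,j+1}=0$ for all $i\ge 2$ and $j\ge i+1$ with $j+1\le n$; (b) $t_{i,i}t_{i+1,i+1}+2m_{i,i+1}t_{i,i+1}=0$ for all $i\ge 2$ with $i+1\le n$.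
   Context: A frieze matrix is a symmetric matrix $M=(m_{i,j})\in \operatorname{Frac}(R)^{n\times n}$ (with $\operatorname{Frac}(R)$ the field of fractions of $R$) such that $m_{i,j}=0$ if and only if $i=j$, and whose entries satisfy the generalized diamond rule \[ m_{i,j}m_{i+1,j+1}-m_{i+1,j}m_{i,j+1}=m_{i,i+1}m_{j,j+1} \] for all indices $1\le i$ and $j\ge i+1$ with $j+1\le n$. -}

module Defs where

open import Level using (Level; _⊔_; suc)
open import Data.Nat as ℕ using (ℕ; zero; _<ᵇ_)
open import Data.Product using (Σ; ∃; _×_; _,_)
open import Data.Sum using (_⊎_)
open import Data.Bool using (if_then_else_)
open import Relation.Binary.PropositionalEquality using (_≡_)
open import Relation.Nullary using (¬_)
open import Function.Bundles using (_⇔_)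
open import Algebra.Bundles using (CommutativeRing; RawRing)
open import Algebra.Morphism.Structures using (module RingMorphisms)
import Algebra.Definitions.RawSemiring as RawSemiringDefs

record IsIntegralDomain {c ℓ} (R : CommutativeRing c ℓ) : Set (c ⊔ ℓ) where
  open CommutativeRing R
  field
    1≉0           : ¬ (1# ≈ 0#)
    noZeroDivisor : ∀ x y → x * y ≈ 0# → (x ≈ 0#) ⊎ (y ≈ 0#)

CharacteristicZero : ∀ {c ℓ} (R : CommutativeRing c ℓ) → Set ℓ
CharacteristicZero R = ∀ (k : ℕ) → k ·ℕ 1# ≈ 0# → k ≡ 0
  where
  open CommutativeRing R
  open RawSemiringDefs (RawRing.rawSemiring rawRing) renaming (_×_ to _·ℕ_)

-- Fields, with a total inverse operation (value at 0 irrelevant)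

record IsField {c ℓ} (K : CommutativeRing c ℓ) : Set (c ⊔ ℓ) where
  open CommutativeRing K
  field
    1≉0      : ¬ (1# ≈ 0#)
    _⁻¹      : Carrier → Carrier
    ⁻¹-cong  : ∀ {x y} → x ≈ y → x ⁻¹ ≈ y ⁻¹
    inverseʳ : ∀ x → ¬ (x ≈ 0#) → x * (x ⁻¹) ≈ 1#

record IsFractionField {c₁ ℓ₁ c₂ ℓ₂} (R : CommutativeRing c₁ ℓ₁)
       (K : CommutativeRing c₂ ℓ₂) (ι : CommutativeRing.Carrier R → CommutativeRing.Carrier K)
       : Set (c₁ ⊔ ℓ₁ ⊔ c₂ ⊔ ℓ₂) where
  module R = CommutativeRing R
  module K = CommutativeRing K
  open RingMorphisms R.rawRing K.rawRing
  field
    isField            : IsField K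
    isRingMonomorphism : IsRingMonomorphism ι
    surjectiveFrac     : ∀ (x : K.Carrier) →
                         Σ R.Carrier λ a → Σ R.Carrier λ b →
                           (¬ (b R.≈ R.0#)) × (x K.* ι b K.≈ ι a)

-- Matrices with entries in K are functions ℕ → ℕ → K, indices 1..n used
-- (entries with an index outside 1..n are irrelevant).

module _ {c ℓ} (K : CommutativeRing c ℓ) where
  open CommutativeRing K

  record IsFriezeMatrix (n : ℕ) (m : ℕ → ℕ → Carrier) : Set (c ⊔ ℓ) where
    field
      symmetric : ∀ i j → 1 ℕ.≤ i → i ℕ.≤ n → 1 ℕ.≤ j → j ℕ.≤ n →
                  m i j ≈ m j i
      zero-iff  : ∀ i j → 1 ℕ.≤ i → i ℕ.≤ n → 1 ℕ.≤ j → j ℕ.≤ n →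
                  (m i j ≈ 0#) ⇔ (i ≡ j)
      diamond   : ∀ i j → 1 ℕ.≤ i → i ℕ.+ 1 ℕ.≤ j → j ℕ.+ 1 ℕ.≤ n →
                  m i j * m (i ℕ.+ 1) (j ℕ.+ 1) - m (i ℕ.+ 1) j * m i (j ℕ.+ 1)
                    ≈ m i (i ℕ.+ 1) * m j (j ℕ.+ 1)

  T : (_⁻¹ : Carrier → Carrier) → (ℕ → ℕ → Carrier) → ℕ → ℕ → Carrier
  T _⁻¹ m 1 j = m 2 j
  T _⁻¹ m 2 j = m 1 j
  T _⁻¹ m (ℕ.suc (ℕ.suc (ℕ.suc k))) j =
    if j <ᵇ i then 0#
    else ((- (two * m 1 j)) * (m 1 (i ℕ.∸ 1) ⁻¹)) * m (i ℕ.∸ 1) i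
    where
    i = ℕ.suc (ℕ.suc (ℕ.suc k))
    two = 1# + 1#
  T _⁻¹ m 0 j = 0#   -- index 0 is outside the matrix; irrelevant

-- For i ≥ 2 every upper-triangular entry of T_M factors as t i j = m 1 j · c i (rowScale i below), where c 2 = 1
-- and c (i + 1) = −2 m i (i+1) / m 1 i.  Part (a) is then the vanishing of a 2×2 minor of
-- a rank-one matrix, and part (b) reduces to m 1 i · c (i + 1) = −2 m i (i+1), which holds
-- because m 1 i ≠ 0 for i ≠ 1 in a frieze matrix.
module Submission where

open import Defs
open import Data.Nat using (ℕ; suc; _≤_; z≤n; s≤s; _<ᵇ_) renaming (_+_ to _+ℕ_)
open import Data.Nat.Properties as ℕ using (≤-trans; ≤-refl; m≤m+n; +-monoˡ-≤)
open import Data.Bool using (false)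
open import Data.Bool.Properties using (if-cong)
open import Data.Product using (_×_; _,_)
open import Relation.Nullary using (¬_)
open import Relation.Binary.PropositionalEquality as ≡ using (_≡_; _≢_)
open import Function.Bundles using (Equivalence)
open import Algebra.Bundles using (CommutativeRing)
import Algebra.Properties.Ring as RingProperties
import Algebra.Solver.Ring.NaturalCoefficients.Default as SemiringSolver

≤⇒≮ᵇ : ∀ {i j} → i ≤ j → (j <ᵇ i) ≡ false
≤⇒≮ᵇ z≤n             = ≡.refl
≤⇒≮ᵇ (s≤s z≤n)       = ≡.refl
≤⇒≮ᵇ (s≤s (s≤s i≤j)) = ≤⇒≮ᵇ (s≤s i≤j)

module _ {c ℓ} (K : CommutativeRing c ℓ) where
  open CommutativeRing K
  open RingProperties ring using (-‿distribˡ-*; x≈y⇒x∙y⁻¹≈ε)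
  open SemiringSolver commutativeSemiring using (solve; _:=_; _:*_; _:+_)
  open import Relation.Binary.Reasoning.Setoid setoid

  rankOne-minor≈0 : ∀ x y p q → (x * p) * (y * q) - (x * q) * (y * p) ≈ 0#
  rankOne-minor≈0 x y p q = x≈y⇒x∙y⁻¹≈ε (exchange x y p q)
    where
    exchange : ∀ x y p q → (x * p) * (y * q) ≈ (x * q) * (y * p)
    exchange = solve 4 (λ x y p q → (x :* p) :* (y :* q) := (x :* q) :* (y :* p)) refl

  factor-≈0 : ∀ x y p q w → x * q ≈ - w → (x * p) * (y * q) + w * (y * p) ≈ 0#
  factor-≈0 x y p q w xq≈-w = begin
    (x * p) * (y * q) + w * (y * p)  ≈⟨ regroup x y p q w ⟩
    (y * p) * (x * q + w)            ≈⟨ *-congˡ (+-congʳ xq≈-w) ⟩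
    (y * p) * (- w + w)              ≈⟨ *-congˡ (-‿inverseˡ w) ⟩
    (y * p) * 0#                     ≈⟨ zeroʳ (y * p) ⟩
    0#                               ∎
    where
    regroup : ∀ x y p q w → (x * p) * (y * q) + w * (y * p) ≈ (y * p) * (x * q + w)
    regroup = solve 5 (λ x y p q w →
      (x :* p) :* (y :* q) :+ w :* (y :* p) := (y :* p) :* (x :* q :+ w)) refl

  offDiagonal≉0 : ∀ {n m i j} → IsFriezeMatrix K n m →
                  1 ≤ i → i ≤ n → 1 ≤ j → j ≤ n → i ≢ j → ¬ m i j ≈ 0#
  offDiagonal≉0 {i = i} {j} frieze 1≤i i≤n 1≤j j≤n i≢j mij≈0 =
    i≢j (Equivalence.to (IsFriezeMatrix.zero-iff frieze i j 1≤i i≤n 1≤j j≤n) mij≈0)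

  module RowScaling (isField : IsField K) (m : ℕ → ℕ → Carrier) where
    open IsField isField using (_⁻¹; inverseʳ)

    two : Carrier
    two = 1# + 1#

    t : ℕ → ℕ → Carrier
    t = T K _⁻¹ m

    -- Only the values at i ≥ 2 matter.
    rowScale : ℕ → Carrier
    rowScale 2 = 1#
    rowScale (suc i@(suc (suc _))) = ((- two) * m 1 i ⁻¹) * m i (suc i)
    rowScale _ = 0#

    t≈m1j*rowScale : ∀ i j → 2 ≤ i → i ≤ j → t i j ≈ m 1 j * rowScale i
    t≈m1j*rowScale 1 _ (s≤s ()) _
    t≈m1j*rowScale 2 j _ _ = sym (*-identityʳ (m 1 j))
    t≈m1j*rowScale (suc i@(suc (suc _))) j _ i<j = begin
      t (suc i) j                                   ≡⟨ if-cong (≤⇒≮ᵇ i<j) ⟩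
      ((- (two * m 1 j)) * m 1 i ⁻¹) * m i (suc i)  ≈⟨ *-congʳ (*-congʳ (-‿distribˡ-* two (m 1 j))) ⟩
      (((- two) * m 1 j) * m 1 i ⁻¹) * m i (suc i)  ≈⟨ pull (- two) (m 1 j) (m 1 i ⁻¹) (m i (suc i)) ⟩
      m 1 j * rowScale (suc i)                      ∎
      where
      pull : ∀ w x a b → ((w * x) * a) * b ≈ x * ((w * a) * b)
      pull = solve 4 (λ w x a b → ((w :* x) :* a) :* b := x :* ((w :* a) :* b)) refl

    m1i*rowScale-next : ∀ i → 2 ≤ i → ¬ m 1 i ≈ 0# →
                        m 1 i * rowScale (i +ℕ 1) ≈ - (two * m i (i +ℕ 1))
    m1i*rowScale-next 1 (s≤s ()) _
    m1i*rowScale-next i@(suc (suc k)) _ m1i≉0 rewrite ℕ.+-comm k 1 = begin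
      x * (((- two) * x ⁻¹) * b)  ≈⟨ regroup x (x ⁻¹) (- two) b ⟩
      (x * x ⁻¹) * ((- two) * b)  ≈⟨ *-congʳ (inverseʳ x m1i≉0) ⟩
      1# * ((- two) * b)          ≈⟨ *-identityˡ _ ⟩
      (- two) * b                 ≈⟨ -‿distribˡ-* two b ⟨
      - (two * b)                 ∎
      where
      x b : Carrier
      x = m 1 i
      b = m i (suc i)
      regroup : ∀ x e w b → x * ((w * e) * b) ≈ (x * e) * (w * b)
      regroup = solve 4 (λ x e w b → x :* ((w :* e) :* b) := (x :* e) :* (w :* b)) refl

    t-minor≈0 : ∀ i j → 2 ≤ i → i +ℕ 1 ≤ j →
                t i j * t (i +ℕ 1) (j +ℕ 1) - t (i +ℕ 1) j * t i (j +ℕ 1) ≈ 0#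
    t-minor≈0 i j 2≤i i<j = begin
      t i j * t (i +ℕ 1) (j +ℕ 1) - t (i +ℕ 1) j * t i (j +ℕ 1)
        ≈⟨ +-cong (*-cong (t≈m1j*rowScale i j 2≤i i≤j) (t≈m1j*rowScale (i +ℕ 1) (j +ℕ 1) 2≤i+1 i+1≤j+1))
                  (-‿cong (*-cong (t≈m1j*rowScale (i +ℕ 1) j 2≤i+1 i<j) (t≈m1j*rowScale i (j +ℕ 1) 2≤i i≤j+1))) ⟩
      (m 1 j * rowScale i) * (m 1 (j +ℕ 1) * rowScale (i +ℕ 1))
        - (m 1 j * rowScale (i +ℕ 1)) * (m 1 (j +ℕ 1) * rowScale i)
        ≈⟨ rankOne-minor≈0 (m 1 j) (m 1 (j +ℕ 1)) (rowScale i) (rowScale (i +ℕ 1)) ⟩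
      0# ∎
      where
      i≤j : i ≤ j
      i≤j = ≤-trans (m≤m+n i 1) i<j
      2≤i+1 : 2 ≤ i +ℕ 1
      2≤i+1 = ≤-trans 2≤i (m≤m+n i 1)
      i+1≤j+1 : i +ℕ 1 ≤ j +ℕ 1
      i+1≤j+1 = +-monoˡ-≤ 1 i≤j
      i≤j+1 : i ≤ j +ℕ 1
      i≤j+1 = ≤-trans i≤j (m≤m+n j 1)

    t-diagonal≈0 : ∀ i → 2 ≤ i → ¬ m 1 i ≈ 0# →
                   t i i * t (i +ℕ 1) (i +ℕ 1) + (two * m i (i +ℕ 1)) * t i (i +ℕ 1) ≈ 0#
    t-diagonal≈0 i 2≤i m1i≉0 = begin
      t i i * t (i +ℕ 1) (i +ℕ 1) + (two * m i (i +ℕ 1)) * t i (i +ℕ 1)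
        ≈⟨ +-cong (*-cong (t≈m1j*rowScale i i 2≤i ≤-refl) (t≈m1j*rowScale (i +ℕ 1) (i +ℕ 1) 2≤i+1 ≤-refl))
                  (*-congˡ (t≈m1j*rowScale i (i +ℕ 1) 2≤i (m≤m+n i 1))) ⟩
      (m 1 i * rowScale i) * (m 1 (i +ℕ 1) * rowScale (i +ℕ 1))
        + (two * m i (i +ℕ 1)) * (m 1 (i +ℕ 1) * rowScale i)
        ≈⟨ factor-≈0 (m 1 i) (m 1 (i +ℕ 1)) (rowScale i) (rowScale (i +ℕ 1)) (two * m i (i +ℕ 1))
                     (m1i*rowScale-next i 2≤i m1i≉0) ⟩
      0# ∎
      where
      2≤i+1 : 2 ≤ i +ℕ 1
      2≤i+1 = ≤-trans 2≤i (m≤m+n i 1)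

proposition2p8 : ∀ {c₁ ℓ₁ c₂ ℓ₂} (R : CommutativeRing c₁ ℓ₁) → IsIntegralDomain R → CharacteristicZero R →
    (K : CommutativeRing c₂ ℓ₂) (ι : CommutativeRing.Carrier R → CommutativeRing.Carrier K)
    (frac : IsFractionField R K ι) →
    (n : ℕ) → 2 ≤ n → (m : ℕ → ℕ → CommutativeRing.Carrier K) → IsFriezeMatrix K n m →
    let open CommutativeRing K
        t = T K (IsField._⁻¹ (IsFractionField.isField frac)) m
    in (∀ i j → 2 ≤ i → i +ℕ 1 ≤ j → j +ℕ 1 ≤ n →
          t i j * t (i +ℕ 1) (j +ℕ 1) - t (i +ℕ 1) j * t i (j +ℕ 1) ≈ 0#)
       × (∀ i → 2 ≤ i → i +ℕ 1 ≤ n →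
          t i i * t (i +ℕ 1) (i +ℕ 1) + ((1# + 1#) * m i (i +ℕ 1)) * t i (i +ℕ 1) ≈ 0#)
proposition2p8 R _ _ K ι frac n _ m frieze =
  (λ i j 2≤i i<j _ → t-minor≈0 i j 2≤i i<j) ,
  (λ i 2≤i i<n → t-diagonal≈0 i 2≤i (m1i≉0 i 2≤i (≤-trans (m≤m+n i 1) i<n)))
  where
  open RowScaling K (IsFractionField.isField frac) m
  open CommutativeRing K using (_≈_; 0#)

  m1i≉0 : ∀ i → 2 ≤ i → i ≤ n → ¬ m 1 i ≈ 0#
  m1i≉0 i 2≤i i≤n = offDiagonal≉0 K frieze ≤-refl (≤-trans 1≤i i≤n) 1≤i i≤n (ℕ.<⇒≢ 2≤i)
    where
    1≤i : 1 ≤ i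
    1≤i = ℕ.<⇒≤ 2≤i
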